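{- Let $p$ be a prime with $p \equiv 1 \pmod 4$, and let $a$ be a positive integer with $a < p$ that is a quadratic non-residue modulo $p$. Let $$\Gamma_{p,a} = \left\{ \begin{pmatrix} x_0 + x_1\sqrt{a} & \sqrt{p}\,(x_2 + x_3\sqrt{a}) \\ \sqrt{p}\,(x_2 - x_3\sqrt{a}) & x_0 - x_1\sqrt{a} \end{pmatrix} \;:\; x_0,x_1,x_2,x_3 \in \mathbb{Z},\ x_0^2 - a x_1^2 - p x_2^2 + a p x_3^2 = 1 \right\} \subset SL(2,\mathbb{R}).$$ Then every element of finite order in $\Gamma_{p,a}$ is equal to $\pm \mathrm{Id}$; equivalently, the image of $\Gamma_{p,a}$ in $PSL(2,\mathbb{R})$ is torsion free.
   Context: $\Gamma_{p,a}$ is a group under matrix multiplication (it is the image of the group of norm-one elements of the order $\mathbb{Z}[1,i,j,ij]$ in the quaternion algebra with $i^2=a$, $j^2=p$, $ij=-ji$). -}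

module Defs where

open import Data.Nat using (ℕ; zero; suc; _%_)
import Data.Nat as ℕ
open import Data.Integer using (ℤ; +_; _+_; _-_; _*_; -_)
open import Relation.Binary.PropositionalEquality using (_≡_)
open import Relation.Nullary using (¬_)

QuadNonResidue : (p a : ℕ) → .{{_ : ℕ.NonZero p}} → Set
QuadNonResidue p a = ∀ (x : ℕ) → ¬ ((x ℕ.* x) % p ≡ a % p)

-- An element of Γ_{p,a} is encoded by its integer coordinates (x0,x1,x2,x3),
-- standing for the matrix
--   [ x0 + x1√a          √p (x2 + x3√a) ]
--   [ √p (x2 - x3√a)     x0 - x1√a      ]
-- (equivalently the quaternion x0 + x1 i + x2 j + x3 ij, i²=a, j²=p, ij=-ji).
record Quad : Set where
  constructor quad
  field
    x0 x1 x2 x3 : ℤ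

open Quad public

det : (p a : ℕ) → Quad → ℤ
det p a (quad x0 x1 x2 x3) =
  x0 * x0 - (+ a) * (x1 * x1) - (+ p) * (x2 * x2) + (+ a) * (+ p) * (x3 * x3)

InΓ : (p a : ℕ) → Quad → Set
InΓ p a x = det p a x ≡ + 1

-- Matrix multiplication of the matrices above, expressed in coordinates
-- (this is the quaternion product in Z[1,i,j,ij]).
mul : (p a : ℕ) → Quad → Quad → Quad
mul p a (quad x0 x1 x2 x3) (quad y0 y1 y2 y3) = quad
  (x0 * y0 + (+ a) * (x1 * y1) + (+ p) * (x2 * y2) - (+ a) * (+ p) * (x3 * y3))
  (x0 * y1 + x1 * y0 - (+ p) * (x2 * y3) + (+ p) * (x3 * y2))
  (x0 * y2 + x2 * y0 + (+ a) * (x1 * y3) - (+ a) * (x3 * y1))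
  (x0 * y3 + x3 * y0 + x1 * y2 - x2 * y1)

idΓ : Quad
idΓ = quad (+ 1) (+ 0) (+ 0) (+ 0)

negIdΓ : Quad
negIdΓ = quad (- (+ 1)) (+ 0) (+ 0) (+ 0)

pow : (p a : ℕ) → Quad → ℕ → Quad
pow p a g zero = idΓ
pow p a g (suc n) = mul p a g (pow p a g n)

module Submission where

-- Write g = x0 + x1 i + x2 j + x3 ij with norm 1 and
-- trace t = 2·x0. By Cayley–Hamilton g² = t g - 1, so every power is
-- g^n = U t n · g + V t n with Chebyshev-type integer coefficients.
--
-- * Non-zero trace: |t| ≥ 2 makes |U t n| strictly increasing, so
--   g^(n+1) = 1 forces x1 = x2 = x3 = 0 and then x0 = ±1
--   (torsion-nonzero-trace).
-- * Zero trace: the norm equation gives a·x1² ≡ -1 (mod p). After basic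
--   arithmetic modulo p (congruences, inverses via Bézout) comes a pairing
--   lemma for products over lists: pairing x with x⁻¹ proves Wilson's
--   theorem, and pairing x with -x⁻¹ shows that -1 is a square when
--   p ≡ 1 (mod 4). Then a·x1² ≡ -1 would make the non-residue a a square.

open import Defs
open import Data.Nat as ℕ using (ℕ; zero; suc; _%_; _<_; _≤_; _≥_)
import Data.Nat.Properties as ℕ
import Data.Nat.Tactic.RingSolver as ℕ-Solver
open import Data.Nat.Divisibility as ℕ using (>⇒∤; ∣1⇒≡1)
open import Data.Nat.DivMod using (m≡m%n+[m/n]*n)
open import Data.Nat.Primality using (Prime; prime⇒nonZero; prime⇒nonTrivial; euclidsLemma)
open import Data.Nat.Coprimality using (coprime?; coprime-Bézout; prime⇒coprime)
open import Data.Nat.GCD using (module Bézout)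
open import Data.Nat.ListAction using (product)
open import Data.Nat.ListAction.Properties using (product-↭; product-++)
open import Data.Integer as ℤ
  using (ℤ; +_; -[1+_]; +[1+_]; _+_; _-_; _*_; -_; _^_; ∣_∣; _%ℕ_; _/ℕ_)
open import Data.Integer.Properties
  using ( +-injective; +-identityʳ; +-inverseʳ; *-identityˡ; *-identityʳ; *-zeroʳ; *-comm
        ; *-assoc; neg-distribˡ-*; pos-+; pos-*; abs-*; ∣i∣≡0⇒i≡0; i-j≡0⇒i≡j
        ; [+m]-[+n]≡m⊖n; ∣m⊝n∣≤m⊔n; i*j≡0⇒i≡0∨j≡0; i^n≡0⇒i≡0; ^-zeroˡ; ^-*-assoc
        ; _≟_)
open import Data.Integer.DivMod using (n%ℕd<d; a≡a%ℕn+[a/ℕn]*n)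
open import Data.Integer.Divisibility.Signed
  using (_∣_; divides; ∣⇒∣ᵤ; ∣ᵤ⇒∣; ∣m⇒∣-m; ∣m∣n⇒∣m+n; ∣m⇒∣m*n; ∣n⇒∣m*n)
open import Data.Integer.Tactic.RingSolver using (solve-∀)
open import Data.List using (List; []; _∷_; _++_; [_]; length; applyUpTo)
open import Data.List.Properties using (applyUpTo-∷ʳ; length-applyUpTo)
open import Data.List.Membership.Propositional using (_∈_)
open import Data.List.Membership.Propositional.Properties
  using (∈-∃++; ∈-applyUpTo⁺; ∈-applyUpTo⁻)
open import Data.List.Relation.Unary.Any using (here; there)
open import Data.List.Relation.Unary.All using (_∷_; lookup)
open import Data.List.Relation.Unary.Unique.Propositional using (Unique; _∷_)
open import Data.List.Relation.Unary.Unique.Propositional.Properties using (applyUpTo⁺₁)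
open import Data.List.Relation.Binary.Permutation.Propositional
  using (_↭_; ↭-sym; ↭-trans; prep; ↭⇒↭ₛ)
open import Data.List.Relation.Binary.Permutation.Propositional.Properties
  using (shift; ∈-resp-↭; ↭-length)
import Data.List.Relation.Binary.Permutation.Setoid.Properties as ↭ₛ
open import Data.Product using (∃; ∃₂; _×_; _,_; proj₁; proj₂)
open import Data.Sum as Sum using (_⊎_; inj₁; inj₂; [_,_]′)
open import Data.Empty using (⊥-elim)
open import Relation.Nullary using (¬_; yes; no)
open import Relation.Binary using (Setoid; IsEquivalence)
open import Relation.Binary.PropositionalEquality
  using (_≡_; _≢_; refl; sym; trans; cong; cong₂; subst; setoid; module ≡-Reasoning)
import Relation.Binary.Reasoning.Setoid

quad-≡ : ∀ {x0 x1 x2 x3 y0 y1 y2 y3} →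
  x0 ≡ y0 → x1 ≡ y1 → x2 ≡ y2 → x3 ≡ y3 → quad x0 x1 x2 x3 ≡ quad y0 y1 y2 y3
quad-≡ refl refl refl refl = refl

lin : ℤ → ℤ → Quad → Quad
lin u v (quad x0 x1 x2 x3) = quad (u * x0 + v) (u * x1) (u * x2) (u * x3)

-- Coefficients of X^n = U t n · X + V t n in ℤ[X]/(X² - tX + 1),
-- computed by X^(n+1) = X · X^n.
chebyshev : ℤ → ℕ → ℤ × ℤ
chebyshev t zero    = + 0 , + 1
chebyshev t (suc n) = let u , v = chebyshev t n in t * u + v , - u

U V : ℤ → ℕ → ℤ
U t n = proj₁ (chebyshev t n)
V t n = proj₂ (chebyshev t n)

-- Cayley–Hamilton: an element g of norm 1 and trace t = 2·x0 satisfies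
-- g² = t g - 1, hence g · (u g + v) = (t u + v) g - u.
cayley-hamilton-step : ∀ p a x0 x1 x2 x3 u v → InΓ p a (quad x0 x1 x2 x3) →
  mul p a (quad x0 x1 x2 x3) (lin u v (quad x0 x1 x2 x3))
    ≡ lin ((x0 + x0) * u + v) (- u) (quad x0 x1 x2 x3)
cayley-hamilton-step p a x0 x1 x2 x3 u v det≡1 = quad-≡
  (begin
    x0 * (u * x0 + v) + A * (x1 * (u * x1)) + P * (x2 * (u * x2)) - A * P * (x3 * (u * x3))
      ≡⟨ scalar x0 x1 x2 x3 A P u v ⟩
    w + u * (+ 1 - det p a (quad x0 x1 x2 x3))
      ≡⟨ cong (λ d → w + u * (+ 1 - d)) det≡1 ⟩
    w + u * + 0
      ≡⟨ cong (λ z → w + z) (*-zeroʳ u) ⟩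
    w + + 0
      ≡⟨ +-identityʳ w ⟩
    w ∎)
  (vector₁ x0 x1 x2 x3 P u v) (vector₂ x0 x1 x2 x3 A u v) (vector₃ x0 x1 x2 x3 u v)
  where
  open ≡-Reasoning
  A = + a
  P = + p
  w = ((x0 + x0) * u + v) * x0 + - u
  scalar : ∀ x0 x1 x2 x3 A P u v →
    x0 * (u * x0 + v) + A * (x1 * (u * x1)) + P * (x2 * (u * x2)) - A * P * (x3 * (u * x3))
      ≡ (((x0 + x0) * u + v) * x0 + - u)
        + u * (+ 1 - (x0 * x0 - A * (x1 * x1) - P * (x2 * x2) + A * P * (x3 * x3)))
  scalar = solve-∀
  vector₁ : ∀ x0 x1 x2 x3 P u v →
    x0 * (u * x1) + x1 * (u * x0 + v) - P * (x2 * (u * x3)) + P * (x3 * (u * x2))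
      ≡ ((x0 + x0) * u + v) * x1
  vector₁ = solve-∀
  vector₂ : ∀ x0 x1 x2 x3 A u v →
    x0 * (u * x2) + x2 * (u * x0 + v) + A * (x1 * (u * x3)) - A * (x3 * (u * x1))
      ≡ ((x0 + x0) * u + v) * x2
  vector₂ = solve-∀
  vector₃ : ∀ x0 x1 x2 x3 u v →
    x0 * (u * x3) + x3 * (u * x0 + v) + x1 * (u * x2) - x2 * (u * x1)
      ≡ ((x0 + x0) * u + v) * x3
  vector₃ = solve-∀

pow-chebyshev : ∀ p a x0 x1 x2 x3 → InΓ p a (quad x0 x1 x2 x3) → ∀ n →
  pow p a (quad x0 x1 x2 x3) n ≡ lin (U (x0 + x0) n) (V (x0 + x0) n) (quad x0 x1 x2 x3)
pow-chebyshev p a x0 x1 x2 x3 det≡1 zero = refl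
pow-chebyshev p a x0 x1 x2 x3 det≡1 (suc n) = begin
  mul p a g (pow p a g n)                   ≡⟨ cong (mul p a g) (pow-chebyshev p a x0 x1 x2 x3 det≡1 n) ⟩
  mul p a g (lin (U t n) (V t n) g)         ≡⟨ cayley-hamilton-step p a x0 x1 x2 x3 (U t n) (V t n) det≡1 ⟩
  lin (U t (suc n)) (V t (suc n)) g         ∎
  where
  open ≡-Reasoning
  g = quad x0 x1 x2 x3
  t = x0 + x0

chebyshev-increasing : ∀ k n → ∃₂ λ m d →
  U (+ (2 ℕ.+ k)) n ≡ + m × U (+ (2 ℕ.+ k)) (suc n) ≡ + (m ℕ.+ suc d)
chebyshev-increasing k zero = 0 , 0 , refl , cong (λ z → z + + 1) (*-zeroʳ (+ (2 ℕ.+ k)))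
chebyshev-increasing k (suc n) with chebyshev-increasing k n
... | m , d , Uₙ , Uₙ₊₁ = M , d ℕ.+ k ℕ.* M , Uₙ₊₁ , (begin
  t * U t (suc n) + - U t n   ≡⟨ cong₂ (λ x y → t * x + - y) Uₙ₊₁ Uₙ ⟩
  t * + M + - + m             ≡⟨ cong (λ z → z + - + m) (sym (pos-* (2 ℕ.+ k) M)) ⟩
  + ((2 ℕ.+ k) ℕ.* M) + - + m ≡⟨ cong (λ z → + z + - + m) (expand k m d) ⟩
  + (m ℕ.+ N) + - + m         ≡⟨ cong (λ z → z + - + m) (pos-+ m N) ⟩
  + m + + N + - + m           ≡⟨ cancel (+ m) (+ N) ⟩
  + N                         ∎)
  where
  open ≡-Reasoning
  t = + (2 ℕ.+ k)
  M = m ℕ.+ suc d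
  N = M ℕ.+ suc (d ℕ.+ k ℕ.* M)
  expand : ∀ k m d → (2 ℕ.+ k) ℕ.* (m ℕ.+ suc d)
    ≡ m ℕ.+ ((m ℕ.+ suc d) ℕ.+ suc (d ℕ.+ k ℕ.* (m ℕ.+ suc d)))
  expand = ℕ-Solver.solve-∀
  cancel : ∀ x y → x + y + - x ≡ y
  cancel = solve-∀

chebyshev-neg : ∀ t n →
  U (- t) n ≡ (- + 1) ^ suc n * U t n × V (- t) n ≡ (- + 1) ^ n * V t n
chebyshev-neg t zero = refl , refl
chebyshev-neg t (suc n) with chebyshev-neg t n
... | Uₙ , Vₙ =
    trans (cong₂ (λ x y → - t * x + y) Uₙ Vₙ) (flipU t ((- + 1) ^ n) (U t n) (V t n))
  , trans (cong -_ Uₙ) (flipV ((- + 1) ^ n) (U t n))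
  where
  flipU : ∀ t s u v → - t * (- + 1 * s * u) + s * v ≡ - + 1 * (- + 1 * s) * (t * u + v)
  flipU = solve-∀
  flipV : ∀ s u → - (- + 1 * s * u) ≡ - + 1 * s * - u
  flipV = solve-∀

U-nonzero : ∀ k n → U (+ (2 ℕ.+ k)) (suc n) ≢ + 0
U-nonzero k n U≡0 with chebyshev-increasing k n
... | m , d , _ , Uₙ₊₁ = ℕ.m+1+n≢0 m (+-injective (trans (sym Uₙ₊₁) U≡0))

double-nonzero : ∀ x → x ≢ + 0 → ∃ λ k → x + x ≡ + (2 ℕ.+ k) ⊎ x + x ≡ - + (2 ℕ.+ k)
double-nonzero (+ zero)  x≢0 = ⊥-elim (x≢0 refl)
double-nonzero +[1+ m ]  _   = m ℕ.+ m , inj₁ (cong (λ z → + suc z) (ℕ.+-suc m m))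
double-nonzero -[1+ m ]  _   = m ℕ.+ m , inj₂ refl

U-neg-nonzero : ∀ t n → U t n ≢ + 0 → U (- t) n ≢ + 0
U-neg-nonzero t n U≢0 U[-t]≡0 =
  [ (λ sign≡0 → -1≢0 (i^n≡0⇒i≡0 (- + 1) (suc n) sign≡0)) , U≢0 ]′
    (i*j≡0⇒i≡0∨j≡0 ((- + 1) ^ suc n) (trans (sym (proj₁ (chebyshev-neg t n))) U[-t]≡0))
  where
  -1≢0 : - + 1 ≢ + 0
  -1≢0 ()

U-trace-nonzero : ∀ x0 → x0 ≢ + 0 → ∀ n → U (x0 + x0) (suc n) ≢ + 0
U-trace-nonzero x0 x0≢0 n with double-nonzero x0 x0≢0
... | k , inj₁ 2x0≡t  rewrite 2x0≡t  = U-nonzero k n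
... | k , inj₂ 2x0≡-t rewrite 2x0≡-t = U-neg-nonzero (+ (2 ℕ.+ k)) (suc n) (U-nonzero k n)

scalar-unit : ∀ p a x0 → InΓ p a (quad x0 (+ 0) (+ 0) (+ 0)) →
  (quad x0 (+ 0) (+ 0) (+ 0) ≡ idΓ) ⊎ (quad x0 (+ 0) (+ 0) (+ 0) ≡ negIdΓ)
scalar-unit p a x0 det≡1 = square≡1 x0 (trans (sym (det-scalar x0 (+ a) (+ p))) det≡1)
  where
  det-scalar : ∀ x0 A P → x0 * x0 - A * (+ 0 * + 0) - P * (+ 0 * + 0) + A * P * (+ 0 * + 0) ≡ x0 * x0
  det-scalar = solve-∀
  square≡1 : ∀ x0 → x0 * x0 ≡ + 1 →
    (quad x0 (+ 0) (+ 0) (+ 0) ≡ idΓ) ⊎ (quad x0 (+ 0) (+ 0) (+ 0) ≡ negIdΓ)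
  square≡1 (+ 1)          _  = inj₁ refl
  square≡1 -[1+ 0 ]       _  = inj₂ refl
  square≡1 (+ 0)          ()
  square≡1 +[1+ suc m ]   ()
  square≡1 -[1+ suc m ]   ()

-- A torsion element of Γ with non-zero trace is ±Id: g^(n+1) = U·g + V with
-- U ≠ 0 forces the vector part of g to vanish, and a scalar of norm one is ±1.
torsion-nonzero-trace : ∀ p a x0 x1 x2 x3 → InΓ p a (quad x0 x1 x2 x3) → x0 ≢ + 0 →
  ∀ n → pow p a (quad x0 x1 x2 x3) (suc n) ≡ idΓ →
  (quad x0 x1 x2 x3 ≡ idΓ) ⊎ (quad x0 x1 x2 x3 ≡ negIdΓ)
torsion-nonzero-trace p a x0 x1 x2 x3 det≡1 x0≢0 n gⁿ⁺¹≡1 =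
  scalar-of (cancel (cong Quad.x1 lin≡1)) (cancel (cong Quad.x2 lin≡1))
    (cancel (cong Quad.x3 lin≡1)) det≡1
  where
  u = U (x0 + x0) (suc n)
  lin≡1 : lin u (V (x0 + x0) (suc n)) (quad x0 x1 x2 x3) ≡ idΓ
  lin≡1 = trans (sym (pow-chebyshev p a x0 x1 x2 x3 det≡1 (suc n))) gⁿ⁺¹≡1
  cancel : ∀ {x} → u * x ≡ + 0 → x ≡ + 0
  cancel ux≡0 with i*j≡0⇒i≡0∨j≡0 u ux≡0
  ... | inj₁ u≡0 = ⊥-elim (U-trace-nonzero x0 x0≢0 n u≡0)
  ... | inj₂ x≡0 = x≡0
  scalar-of : x1 ≡ + 0 → x2 ≡ + 0 → x3 ≡ + 0 → InΓ p a (quad x0 x1 x2 x3) →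
    (quad x0 x1 x2 x3 ≡ idΓ) ⊎ (quad x0 x1 x2 x3 ≡ negIdΓ)
  scalar-of refl refl refl = scalar-unit p a x0

interval : ℕ → ℕ → List ℕ
interval lo = applyUpTo (lo ℕ.+_)

interval-unique : ∀ lo n → Unique (interval lo n)
interval-unique lo n = applyUpTo⁺₁ (lo ℕ.+_) n
  (λ i<j _ lo+i≡lo+j → ℕ.<⇒≢ i<j (ℕ.+-cancelˡ-≡ lo _ _ lo+i≡lo+j))

∈-interval⁻ : ∀ {lo n x} → x ∈ interval lo n → lo ≤ x × x < lo ℕ.+ n
∈-interval⁻ {lo} x∈ with i , i<n , refl ← ∈-applyUpTo⁻ (lo ℕ.+_) x∈ =
  ℕ.m≤m+n lo i , ℕ.+-monoʳ-< lo i<n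

∈-interval⁺ : ∀ {lo n x} → lo ≤ x → x < lo ℕ.+ n → x ∈ interval lo n
∈-interval⁺ {lo} {n} {x} lo≤x x<lo+n = subst (_∈ interval lo n) lo+[x∸lo]≡x
  (∈-applyUpTo⁺ (lo ℕ.+_) (ℕ.+-cancelˡ-< lo _ n (subst (_< lo ℕ.+ n) (sym lo+[x∸lo]≡x) x<lo+n)))
  where
  lo+[x∸lo]≡x : lo ℕ.+ (x ℕ.∸ lo) ≡ x
  lo+[x∸lo]≡x = ℕ.m+[n∸m]≡n lo≤x

extract : ∀ {x : ℕ} {S} → x ∈ S → ∃ λ R → S ↭ x ∷ R
extract {x} x∈S with ys , zs , refl ← ∈-∃++ x∈S = ys ++ zs , shift x ys zs

module Congruence (p : ℕ) where

  infix 4 _≈_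
  record _≈_ (x y : ℤ) : Set where
    constructor ≈-from
    field p∣diff : + p ∣ x - y

  ≈-by : ∀ {x y} k → x - y ≡ k * + p → x ≈ y
  ≈-by k eq = ≈-from (divides k eq)

  private
    divides-resp : ∀ {x y} → x ≡ y → + p ∣ x → + p ∣ y
    divides-resp = subst (+ p ∣_)

  ≈-refl : ∀ {x} → x ≈ x
  ≈-refl {x} = ≈-by (+ 0) (+-inverseʳ x)

  ≈-reflexive : ∀ {x y} → x ≡ y → x ≈ y
  ≈-reflexive refl = ≈-refl

  ≈-sym : ∀ {x y} → x ≈ y → y ≈ x
  ≈-sym {x} {y} (≈-from x-y) = ≈-from (divides-resp (swap-diff x y) (∣m⇒∣-m x-y))
    where
    swap-diff : ∀ x y → - (x - y) ≡ y - x
    swap-diff = solve-∀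

  ≈-trans : ∀ {x y z} → x ≈ y → y ≈ z → x ≈ z
  ≈-trans {x} {y} {z} (≈-from x-y) (≈-from y-z) =
    ≈-from (divides-resp (split-diff x y z) (∣m∣n⇒∣m+n x-y y-z))
    where
    split-diff : ∀ x y z → (x - y) + (y - z) ≡ x - z
    split-diff = solve-∀

  +-cong : ∀ {x x′ y y′} → x ≈ x′ → y ≈ y′ → x + y ≈ x′ + y′
  +-cong {x} {x′} {y} {y′} (≈-from x-x′) (≈-from y-y′) =
    ≈-from (divides-resp (sum-diff x x′ y y′) (∣m∣n⇒∣m+n x-x′ y-y′))
    where
    sum-diff : ∀ x x′ y y′ → (x - x′) + (y - y′) ≡ (x + y) - (x′ + y′)
    sum-diff = solve-∀

  *-cong : ∀ {x x′ y y′} → x ≈ x′ → y ≈ y′ → x * y ≈ x′ * y′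
  *-cong {x} {x′} {y} {y′} (≈-from x-x′) (≈-from y-y′) =
    ≈-from (divides-resp (product-diff x x′ y y′)
      (∣m∣n⇒∣m+n (∣m⇒∣m*n y x-x′) (∣n⇒∣m*n x′ y-y′)))
    where
    product-diff : ∀ x x′ y y′ → (x - x′) * y + x′ * (y - y′) ≡ x * y - x′ * y′
    product-diff = solve-∀

  -‿cong : ∀ {x y} → x ≈ y → - x ≈ - y
  -‿cong {x} {y} (≈-from x-y) = ≈-from (divides-resp (negate-diff x y) (∣m⇒∣-m x-y))
    where
    negate-diff : ∀ x y → - (x - y) ≡ - x - - y
    negate-diff = solve-∀

  *-congˡ : ∀ x {y y′} → y ≈ y′ → x * y ≈ x * y′
  *-congˡ x = *-cong (≈-refl {x})

  ≈-isEquivalence : IsEquivalence _≈_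
  ≈-isEquivalence = record { refl = ≈-refl ; sym = ≈-sym ; trans = ≈-trans }

  ≈-setoid : Setoid _ _
  ≈-setoid = record { isEquivalence = ≈-isEquivalence }

  module ≈-Reasoning = Relation.Binary.Reasoning.Setoid ≈-setoid

  record Pairing (b : ℤ) (f : ℕ → ℕ) (S : List ℕ) : Set where
    field
      closed     : ∀ {x} → x ∈ S → f x ∈ S
      no-fixed   : ∀ {x} → x ∈ S → f x ≢ x
      involutive : ∀ {x} → x ∈ S → f (f x) ≡ x
      pair-prod  : ∀ {x} → x ∈ S → + x * + f x ≈ b

  open Pairing

  remove-pair : ∀ {b f x S} → x ∈ S → Unique S → Pairing b f S →
    ∃ λ R → S ↭ x ∷ f x ∷ R × Unique R × Pairing b f R
  remove-pair {b} {f} {x} {S} x∈S uniq P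
    with R₁ , σ₁ ← extract x∈S
    with ∈-resp-↭ σ₁ (closed P x∈S)
  ... | here fx≡x = ⊥-elim (no-fixed P x∈S fx≡x)
  ... | there fx∈R₁
    with R₂ , σ₂ ← extract fx∈R₁
    with σ ← ↭-trans σ₁ (prep x σ₂)
    with x∉ ∷ fx∉ ∷ uniq₂ ← ↭ₛ.Unique-resp-↭ (setoid ℕ) (↭⇒↭ₛ σ) uniq
    = R₂ , σ , uniq₂ , record
      { closed     = closed₂
      ; no-fixed   = λ z∈ → no-fixed P (in-S z∈)
      ; involutive = λ z∈ → involutive P (in-S z∈)
      ; pair-prod  = λ z∈ → pair-prod P (in-S z∈)
      }
    where
    in-S : ∀ {z} → z ∈ R₂ → z ∈ S
    in-S z∈ = ∈-resp-↭ (↭-sym σ) (there (there z∈))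
    closed₂ : ∀ {z} → z ∈ R₂ → f z ∈ R₂
    closed₂ {z} z∈ with ∈-resp-↭ σ (closed P (in-S z∈))
    ... | here fz≡x = ⊥-elim (lookup fx∉ z∈ (begin
      f x       ≡⟨ cong f fz≡x ⟨
      f (f z)   ≡⟨ involutive P (in-S z∈) ⟩
      z         ∎))
      where open ≡-Reasoning
    ... | there (here fz≡fx) = ⊥-elim (lookup x∉ (there z∈) (begin
      x         ≡⟨ involutive P x∈S ⟨
      f (f x)   ≡⟨ cong f fz≡fx ⟨
      f (f z)   ≡⟨ involutive P (in-S z∈) ⟩
      z         ∎))
      where open ≡-Reasoning
    ... | there (there fz∈R₂) = fz∈R₂

  -- Pairing lemma: a list S of length n that is paired up by f splits into
  -- k = n/2 pairs, so its product is b ^ k. (Removing a pair shortens S by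
  -- two, which rules out odd n.)
  pairing : ∀ {b f} n S → length S ≡ n → Unique S → Pairing b f S →
    ∃ λ k → 2 ℕ.* k ≡ n × + product S ≈ b ^ k
  pairing zero    []        refl _    _ = 0 , refl , ≈-refl
  pairing {b} {f} (suc n) (x ∷ xs) len uniq P
    with R , σ , uniqR , PR ← remove-pair (here refl) uniq P
    with n | trans (sym (↭-length σ)) len
  ... | suc m | refl
    with k , 2k≡m , prodR ← pairing m R refl uniqR PR
    = suc k , trans (ℕ.*-suc 2 k) (cong (λ z → 2 ℕ.+ z) 2k≡m) , (begin
      + product (x ∷ xs)                  ≡⟨ cong +_ (product-↭ σ) ⟩
      + (x ℕ.* (y ℕ.* product R))         ≡⟨ pos-product x y (product R) ⟩
      + x * + y * + product R             ≈⟨ *-cong (pair-prod P (here refl)) prodR ⟩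
      b * b ^ k                           ∎)
    where
    open ≈-Reasoning
    y = f x
    pos-product : ∀ x y z → + (x ℕ.* (y ℕ.* z)) ≡ + x * + y * + z
    pos-product x y z =
      trans (pos-* x (y ℕ.* z)) (trans (cong (+ x *_) (pos-* y z)) (sym (*-assoc (+ x) (+ y) (+ z))))

lift-identity : ∀ a b c d → 1 ℕ.+ a ℕ.* b ≡ c ℕ.* d → + 1 + + a * + b ≡ + c * + d
lift-identity a b c d eq = begin
  + 1 + + a * + b       ≡⟨ cong (λ z → + 1 + z) (pos-* a b) ⟨
  + 1 + + (a ℕ.* b)     ≡⟨ pos-+ 1 (a ℕ.* b) ⟨
  + (1 ℕ.+ a ℕ.* b)     ≡⟨ cong +_ eq ⟩
  + (c ℕ.* d)           ≡⟨ pos-* c d ⟩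
  + c * + d             ∎
  where open ≡-Reasoning

module Residues {p : ℕ} (pr : Prime p) where

  open Congruence p public

  instance
    p-nonZero : ℕ.NonZero p
    p-nonZero = prime⇒nonZero pr

  ≈0⇒∣ : ∀ {x} → x ≈ + 0 → + p ∣ x
  ≈0⇒∣ {x} (≈-from p∣x) = subst (+ p ∣_) (+-identityʳ x) p∣x

  ∣⇒≈0 : ∀ {x} → + p ∣ x → x ≈ + 0
  ∣⇒≈0 {x} p∣x = ≈-from (subst (+ p ∣_) (sym (+-identityʳ x)) p∣x)

  diff≈0⇒≈ : ∀ {x y} → x - y ≈ + 0 → x ≈ y
  diff≈0⇒≈ x-y≈0 = ≈-from (≈0⇒∣ x-y≈0)

  1≉0 : ¬ (+ 1 ≈ + 0)
  1≉0 1≈0 = ℕ.nonTrivial⇒≢1 {{prime⇒nonTrivial pr}} (∣1⇒≡1 (∣⇒∣ᵤ (≈0⇒∣ 1≈0)))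

  euclid : ∀ {x y} → x * y ≈ + 0 → x ≈ + 0 ⊎ y ≈ + 0
  euclid {x} {y} xy≈0 =
    Sum.map (λ p∣x → ∣⇒≈0 (∣ᵤ⇒∣ p∣x)) (λ p∣y → ∣⇒≈0 (∣ᵤ⇒∣ p∣y))
    (euclidsLemma ∣ x ∣ ∣ y ∣ pr (subst (p ℕ.∣_) (abs-* x y) (∣⇒∣ᵤ (≈0⇒∣ xy≈0))))

  residue-unique : ∀ {m n} → m < p → n < p → + m ≈ + n → m ≡ n
  residue-unique {m} {n} m<p n<p (≈-from p∣m-n) with ∣ + m - + n ∣ in ∣m-n∣≡d
  ... | zero  = +-injective (i-j≡0⇒i≡j (+ m) (+ n) (∣i∣≡0⇒i≡0 ∣m-n∣≡d))
  ... | suc d = ⊥-elim (>⇒∤ d<p (subst (p ℕ.∣_) ∣m-n∣≡d (∣⇒∣ᵤ p∣m-n)))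
    where
    d<p : suc d < p
    d<p = begin-strict
      suc d              ≡⟨ sym ∣m-n∣≡d ⟩
      ∣ + m - + n ∣       ≡⟨ cong ∣_∣ ([+m]-[+n]≡m⊖n m n) ⟩
      ∣ m ℤ.⊖ n ∣          ≤⟨ ∣m⊝n∣≤m⊔n m n ⟩
      m ℕ.⊔ n            <⟨ ℕ.⊔-lub m<p n<p ⟩
      p                  ∎
      where open ℕ.≤-Reasoning

  ≈-residue : ∀ x → x ≈ + (x %ℕ p)
  ≈-residue x = ≈-by (x /ℕ p) (begin
    x - + (x %ℕ p)                            ≡⟨ cong (λ z → z - + (x %ℕ p)) (a≡a%ℕn+[a/ℕn]*n x p) ⟩
    + (x %ℕ p) + (x /ℕ p) * + p - + (x %ℕ p)  ≡⟨ cancel (+ (x %ℕ p)) ((x /ℕ p) * + p) ⟩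
    (x /ℕ p) * + p                            ∎)
    where
    open ≡-Reasoning
    cancel : ∀ r q → r + q - r ≡ q
    cancel = solve-∀

  ≈⇒%≡ : ∀ {m n} → + m ≈ + n → m % p ≡ n % p
  ≈⇒%≡ {m} {n} m≈n = residue-unique (n%ℕd<d (+ m) p) (n%ℕd<d (+ n) p)
    (≈-trans (≈-sym (≈-residue (+ m))) (≈-trans m≈n (≈-residue (+ n))))

  -1≉0 : ¬ (- + 1 ≈ + 0)
  -1≉0 -1≈0 = 1≉0 (-‿cong -1≈0)

  cancel-left : ∀ {x y z} → ¬ (x ≈ + 0) → x * y ≈ x * z → y ≈ z
  cancel-left {x} {y} {z} x≉0 (≈-from p∣xy-xz) =
    [ (λ x≈0 → ⊥-elim (x≉0 x≈0)) , diff≈0⇒≈ ]′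
      (euclid (∣⇒≈0 (subst (+ p ∣_) (factor x y z) p∣xy-xz)))
    where
    factor : ∀ x y z → x * y - x * z ≡ x * (y - z)
    factor = solve-∀

  unit≉0 : ∀ {x} → 0 < x → x < p → ¬ (+ x ≈ + 0)
  unit≉0 0<x x<p x≈0 = ℕ.n>0⇒n≢0 0<x (residue-unique x<p (ℕ.>-nonZero⁻¹ p) x≈0)

  bezout-inverse : ∀ {x} → Bézout.Identity 1 p x → ℤ
  bezout-inverse (Bézout.+- _ v _) = - + v
  bezout-inverse (Bézout.-+ _ v _) = + v

  bezout-inverse-spec : ∀ {x} (B : Bézout.Identity 1 p x) → + x * bezout-inverse B ≈ + 1
  bezout-inverse-spec {x} (Bézout.+- u v 1+vx≡up) = ≈-by (- + u) (begin
    + x * - + v - + 1          ≡⟨ negate (+ x) (+ v) ⟩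
    - (+ 1 + + v * + x)        ≡⟨ cong -_ (lift-identity v x u p 1+vx≡up) ⟩
    - (+ u * + p)              ≡⟨ neg-distribˡ-* (+ u) (+ p) ⟩
    - + u * + p                ∎)
    where
    open ≡-Reasoning
    negate : ∀ x v → x * - v - + 1 ≡ - (+ 1 + v * x)
    negate = solve-∀
  bezout-inverse-spec {x} (Bézout.-+ u v 1+up≡vx) = ≈-by (+ u) (begin
    + x * + v - + 1            ≡⟨ commute (+ x) (+ v) ⟩
    + v * + x - + 1            ≡⟨ cong (λ z → z - + 1) (lift-identity u p v x 1+up≡vx) ⟨
    + 1 + + u * + p - + 1      ≡⟨ cancel (+ u * + p) ⟩
    + u * + p                  ∎)
    where
    open ≡-Reasoning
    commute : ∀ x v → x * v - + 1 ≡ v * x - + 1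
    commute = solve-∀
    cancel : ∀ z → + 1 + z - + 1 ≡ z
    cancel = solve-∀

  -- An inverse of x modulo p, meaningful when p and x are coprime
  -- (in particular for 0 < x < p).
  inverse : ℕ → ℤ
  inverse x with coprime? p x
  ... | yes p⊥x = bezout-inverse (coprime-Bézout p⊥x)
  ... | no  _   = + 0

  inverse-spec : ∀ {x} → 0 < x → x < p → + x * inverse x ≈ + 1
  inverse-spec {x} 0<x x<p with coprime? p x
  ... | yes p⊥x = bezout-inverse-spec (coprime-Bézout p⊥x)
  ... | no ¬p⊥x = ⊥-elim (¬p⊥x (prime⇒coprime pr {{ℕ.>-nonZero 0<x}} x<p))

  partner : ℤ → ℕ → ℕ
  partner b x = (b * inverse x) %ℕ p

  partner-< : ∀ b x → partner b x < p
  partner-< b x = n%ℕd<d (b * inverse x) p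

  partner-prod : ∀ b {x} → 0 < x → x < p → + x * + partner b x ≈ b
  partner-prod b {x} 0<x x<p = begin
    + x * + partner b x      ≈⟨ *-congˡ (+ x) (≈-sym (≈-residue (b * inverse x))) ⟩
    + x * (b * inverse x)    ≡⟨ rearrange (+ x) b (inverse x) ⟩
    b * (+ x * inverse x)    ≈⟨ *-congˡ b (inverse-spec 0<x x<p) ⟩
    b * + 1                  ≡⟨ *-identityʳ b ⟩
    b                        ∎
    where
    open ≈-Reasoning
    rearrange : ∀ x b i → x * (b * i) ≡ b * (x * i)
    rearrange = solve-∀

  partner-positive : ∀ {b x} → ¬ (b ≈ + 0) → 0 < x → x < p → 0 < partner b x
  partner-positive {b} {x} b≉0 0<x x<p = ℕ.n≢0⇒n>0 λ y≡0 → b≉0 (begin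
    b                        ≈⟨ ≈-sym (partner-prod b 0<x x<p) ⟩
    + x * + partner b x      ≡⟨ cong (λ y → + x * + y) y≡0 ⟩
    + x * + 0                ≡⟨ *-zeroʳ (+ x) ⟩
    + 0                      ∎)
    where open ≈-Reasoning

  partner-involutive : ∀ {b x} → ¬ (b ≈ + 0) → 0 < x → x < p → partner b (partner b x) ≡ x
  partner-involutive {b} {x} b≉0 0<x x<p =
    residue-unique (partner-< b y) x<p (cancel-left (unit≉0 0<y y<p) (begin
      + y * + partner b y    ≈⟨ partner-prod b 0<y y<p ⟩
      b                      ≈⟨ ≈-sym (partner-prod b 0<x x<p) ⟩
      + x * + y              ≡⟨ *-comm (+ x) (+ y) ⟩
      + y * + x              ∎))
    where
    open ≈-Reasoning
    y = partner b x
    0<y = partner-positive b≉0 0<x x<p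
    y<p = partner-< b x

  1<p : 1 < p
  1<p = ℕ.nonTrivial⇒n>1 p {{prime⇒nonTrivial pr}}

  p-1<p : p ℕ.∸ 1 < p
  p-1<p = ℕ.∸-monoʳ-< (ℕ.s≤s ℕ.z≤n) (ℕ.<⇒≤ 1<p)

  p-1≈-1 : + (p ℕ.∸ 1) ≈ - + 1
  p-1≈-1 = ≈-by (+ 1) (begin
    + (p ℕ.∸ 1) - - + 1        ≡⟨ pos-+ (p ℕ.∸ 1) 1 ⟨
    + (p ℕ.∸ 1 ℕ.+ 1)          ≡⟨ cong +_ (ℕ.m∸n+n≡m (ℕ.<⇒≤ 1<p)) ⟩
    + p                        ≡⟨ *-identityˡ (+ p) ⟨
    + 1 * + p                  ∎)
    where open ≡-Reasoning

  ≈1⇒≡1 : ∀ {x} → x < p → + x ≈ + 1 → x ≡ 1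
  ≈1⇒≡1 x<p = residue-unique x<p 1<p

  ≈-1⇒≡p-1 : ∀ {x} → x < p → + x ≈ - + 1 → x ≡ p ℕ.∸ 1
  ≈-1⇒≡p-1 x<p x≈-1 = residue-unique x<p p-1<p (≈-trans x≈-1 (≈-sym p-1≈-1))

  square-root-of-one : ∀ {x} → x * x ≈ + 1 → x ≈ + 1 ⊎ x ≈ - + 1
  square-root-of-one {x} x²≈1 = Sum.map diff≈0⇒≈ diff≈0⇒≈
    (euclid {x - + 1} {x + + 1} (begin
      (x - + 1) * (x + + 1)    ≡⟨ difference-of-squares x ⟩
      x * x - + 1              ≈⟨ +-cong x²≈1 (≈-refl { - + 1}) ⟩
      + 1 - + 1                ≡⟨⟩
      + 0                      ∎))
    where
    open ≈-Reasoning
    difference-of-squares : ∀ x → (x - + 1) * (x + + 1) ≡ x * x - + 1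
    difference-of-squares = solve-∀

  units : List ℕ
  units = interval 1 (p ℕ.∸ 1)

  1+[p-1]≡p : 1 ℕ.+ (p ℕ.∸ 1) ≡ p
  1+[p-1]≡p = ℕ.m+[n∸m]≡n (ℕ.<⇒≤ 1<p)

  ∈-units⁺ : ∀ {x} → 0 < x → x < p → x ∈ units
  ∈-units⁺ {x} 0<x x<p = ∈-interval⁺ 0<x (subst (x <_) (sym 1+[p-1]≡p) x<p)

  ∈-units⁻ : ∀ {x} → x ∈ units → 0 < x × x < p
  ∈-units⁻ {x} x∈ with 1≤x , x<1+[p-1] ← ∈-interval⁻ x∈ = 1≤x , subst (x <_) 1+[p-1]≡p x<1+[p-1]

  partner-pairing : ∀ {b S} → ¬ (b ≈ + 0) → (∀ {x} → x ∈ S → 0 < x × x < p) →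
    (∀ {x} → x ∈ S → partner b x ∈ S) → (∀ {x} → x ∈ S → partner b x ≢ x) →
    Pairing b (partner b) S
  partner-pairing {b} b≉0 unit closed no-fixed = record
    { closed     = closed
    ; no-fixed   = no-fixed
    ; involutive = λ x∈ → let 0<x , x<p = unit x∈ in partner-involutive b≉0 0<x x<p
    ; pair-prod  = λ x∈ → let 0<x , x<p = unit x∈ in partner-prod b 0<x x<p
    }

  -- For p = 3 + r, the inverse map x ↦ x⁻¹ pairs up the residues
  -- 2, …, p - 2: it preserves them and fixes none, since the only
  -- self-inverse units are ±1.
  module Middle (r : ℕ) (p≡3+r : p ≡ 3 ℕ.+ r) where

    S : List ℕ
    S = interval 2 r

    p-1≡2+r : p ℕ.∸ 1 ≡ 2 ℕ.+ r
    p-1≡2+r = cong (ℕ._∸ 1) p≡3+r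

    2+r<p : 2 ℕ.+ r < p
    2+r<p = subst (2 ℕ.+ r <_) (sym p≡3+r) (ℕ.n<1+n (2 ℕ.+ r))

    ∈S⇒unit : ∀ {x} → x ∈ S → 0 < x × x < p
    ∈S⇒unit x∈ = let 2≤x , x<2+r = ∈-interval⁻ x∈ in
      ℕ.<-trans (ℕ.s≤s ℕ.z≤n) 2≤x , ℕ.<-trans x<2+r 2+r<p

    not-±1 : ∀ {x} → x ∈ S → ¬ (+ x ≈ + 1) × ¬ (+ x ≈ - + 1)
    not-±1 x∈ = let 2≤x , x<2+r = ∈-interval⁻ x∈ ; x<p = ℕ.<-trans x<2+r 2+r<p in
        (λ x≈1 → ℕ.<-irrefl (sym (≈1⇒≡1 x<p x≈1)) 2≤x)
      , (λ x≈-1 → ℕ.<-irrefl (trans (≈-1⇒≡p-1 x<p x≈-1) p-1≡2+r) x<2+r)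

    -- If x⁻¹ were ±1 then so would be x.
    closed : ∀ {x} → x ∈ S → partner (+ 1) x ∈ S
    closed {x} x∈ =
      ∈-interval⁺ (ℕ.≤∧≢⇒< 0<y (λ 1≡y → y≢1 (sym 1≡y))) (ℕ.≤∧≢⇒< y≤2+r y≢2+r)
      where
      open ≈-Reasoning
      0<x = proj₁ (∈S⇒unit x∈)
      x<p = proj₂ (∈S⇒unit x∈)
      y = partner (+ 1) x
      0<y = partner-positive 1≉0 0<x x<p
      y≤2+r : y ≤ 2 ℕ.+ r
      y≤2+r = ℕ.≤-pred (subst (y <_) p≡3+r (partner-< (+ 1) x))
      y≢1 : y ≢ 1
      y≢1 y≡1 = proj₁ (not-±1 x∈) (begin
        + x              ≡⟨ *-identityʳ (+ x) ⟨
        + x * + 1        ≡⟨ cong (λ z → + x * + z) y≡1 ⟨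
        + x * + y        ≈⟨ partner-prod (+ 1) 0<x x<p ⟩
        + 1              ∎)
      y≢2+r : y ≢ 2 ℕ.+ r
      y≢2+r y≡2+r = proj₂ (not-±1 x∈) (begin
        + x                  ≡⟨ double-negation (+ x) ⟩
        - (+ x * - + 1)      ≈⟨ -‿cong (*-congˡ (+ x) (≈-sym y≈-1)) ⟩
        - (+ x * + y)        ≈⟨ -‿cong (partner-prod (+ 1) 0<x x<p) ⟩
        - + 1                ∎)
        where
        y≈-1 : + y ≈ - + 1
        y≈-1 = subst (λ n → + n ≈ - + 1) (trans p-1≡2+r (sym y≡2+r)) p-1≈-1
        double-negation : ∀ x → x ≡ - (x * - + 1)
        double-negation = solve-∀

    no-fixed : ∀ {x} → x ∈ S → partner (+ 1) x ≢ x
    no-fixed {x} x∈ y≡x = [ proj₁ (not-±1 x∈) , proj₂ (not-±1 x∈) ]′ (square-root-of-one (begin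
      + x * + x                    ≡⟨ cong (λ z → + x * + z) y≡x ⟨
      + x * + partner (+ 1) x      ≈⟨ partner-prod (+ 1) 0<x x<p ⟩
      + 1                          ∎))
      where
      open ≈-Reasoning
      0<x = proj₁ (∈S⇒unit x∈)
      x<p = proj₂ (∈S⇒unit x∈)

    middle-pairing : Pairing (+ 1) (partner (+ 1)) S
    middle-pairing = partner-pairing 1≉0 ∈S⇒unit closed no-fixed

    units-split : units ≡ 1 ∷ S ++ [ 2 ℕ.+ r ]
    units-split =
      trans (cong (interval 1) p-1≡2+r) (cong (1 ∷_) (sym (applyUpTo-∷ʳ (2 ℕ.+_) r)))

  -- Wilson's theorem: (p - 1)! ≡ -1 (mod p) for an odd prime p. The residues
  -- 2, …, p - 2 pair up with product 1, leaving 1 · (p - 1).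
  wilson : 2 < p → + product units ≈ - + 1
  wilson 2<p = begin
    + product units                    ≡⟨ cong (λ L → + product L) units-split ⟩
    + product (1 ∷ S ++ [ 2 ℕ.+ r ])   ≡⟨ cong (λ n → + (1 ℕ.* n)) (product-++ S [ 2 ℕ.+ r ]) ⟩
    + (1 ℕ.* (product S ℕ.* product [ 2 ℕ.+ r ]))
                                       ≡⟨ product-split (product S) (2 ℕ.+ r) ⟩
    + product S * + (2 ℕ.+ r)          ≈⟨ *-cong prodS≈1 (subst (λ n → + n ≈ - + 1) p-1≡2+r p-1≈-1) ⟩
    + 1 * - + 1                        ≡⟨⟩
    - + 1                              ∎
    where
    open ≈-Reasoning
    r = p ℕ.∸ 3
    open Middle r (sym (ℕ.m+[n∸m]≡n 2<p))
    product-split : ∀ s t → + (1 ℕ.* (s ℕ.* (t ℕ.* 1))) ≡ + s * + t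
    product-split s t = trans (cong +_ (unit-factors s t)) (pos-* s t)
      where
      unit-factors : ∀ s t → 1 ℕ.* (s ℕ.* (t ℕ.* 1)) ≡ s ℕ.* t
      unit-factors = ℕ-Solver.solve-∀
    prodS≈1 : + product S ≈ + 1
    prodS≈1 = let k , _ , prodS = pairing r S (length-applyUpTo (2 ℕ.+_) r) (interval-unique 2 r)
                                          middle-pairing
              in ≈-trans prodS (≈-reflexive (^-zeroˡ k))

  units-count : p % 4 ≡ 1 → p ℕ.∸ 1 ≡ 2 ℕ.* (2 ℕ.* (p ℕ./ 4))
  units-count p%4≡1 = begin
    p ℕ.∸ 1                   ≡⟨ cong (ℕ._∸ 1) (m≡m%n+[m/n]*n p 4) ⟩
    (p % 4 ℕ.+ q ℕ.* 4) ℕ.∸ 1 ≡⟨ cong (λ r → (r ℕ.+ q ℕ.* 4) ℕ.∸ 1) p%4≡1 ⟩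
    q ℕ.* 4                   ≡⟨ times-four q ⟩
    2 ℕ.* (2 ℕ.* q)           ∎
    where
    open ≡-Reasoning
    q = p ℕ./ 4
    times-four : ∀ q → q ℕ.* 4 ≡ 2 ℕ.* (2 ℕ.* q)
    times-four = ℕ-Solver.solve-∀

  p≢2 : p % 4 ≡ 1 → p ≢ 2
  p≢2 p%4≡1 p≡2 with () ← subst (λ n → n % 4 ≡ 1) p≡2 p%4≡1

  negative-inverse-pairing : (∀ y → ¬ (y * y ≈ - + 1)) → Pairing (- + 1) (partner (- + 1)) units
  negative-inverse-pairing no-root = partner-pairing -1≉0 ∈-units⁻ closed no-fixed
    where
    closed : ∀ {x} → x ∈ units → partner (- + 1) x ∈ units
    closed {x} x∈ = let 0<x , x<p = ∈-units⁻ x∈ in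
      ∈-units⁺ (partner-positive -1≉0 0<x x<p) (partner-< (- + 1) x)
    no-fixed : ∀ {x} → x ∈ units → partner (- + 1) x ≢ x
    no-fixed {x} x∈ y≡x = no-root (+ x) (begin
      + x * + x                    ≡⟨ cong (λ z → + x * + z) y≡x ⟨
      + x * + partner (- + 1) x    ≈⟨ partner-prod (- + 1) 0<x x<p ⟩
      - + 1                        ∎)
      where
      open ≈-Reasoning
      0<x = proj₁ (∈-units⁻ x∈)
      x<p = proj₂ (∈-units⁻ x∈)

  -- If p ≡ 1 (mod 4) then -1 is a square modulo p: otherwise pairing x with
  -- -x⁻¹ gives (p - 1)! ≡ (-1)^(2q) = 1, contradicting Wilson (as p ≠ 2).
  minus-one-square : p % 4 ≡ 1 → ¬ (∀ y → ¬ (y * y ≈ - + 1))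
  minus-one-square p%4≡1 no-root =
    p≢2 p%4≡1 (trans (sym (ℕ.m∸n+n≡m (ℕ.<⇒≤ 1<p))) (cong (ℕ._+ 1) (sym (≈-1⇒≡p-1 1<p 1≈-1))))
    where
    q = p ℕ./ 4
    paired = pairing (p ℕ.∸ 1) units (length-applyUpTo (1 ℕ.+_) (p ℕ.∸ 1))
                     (interval-unique 1 (p ℕ.∸ 1)) (negative-inverse-pairing no-root)
    k = proj₁ paired
    k≡2q : k ≡ 2 ℕ.* q
    k≡2q = ℕ.*-cancelˡ-≡ k (2 ℕ.* q) 2 (trans (proj₁ (proj₂ paired)) (units-count p%4≡1))
    1≈-1 : + 1 ≈ - + 1
    1≈-1 = begin
      + 1                       ≡⟨ ^-zeroˡ q ⟨
      (+ 1) ^ q                 ≡⟨ ^-*-assoc (- + 1) 2 q ⟩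
      (- + 1) ^ (2 ℕ.* q)       ≡⟨ cong ((- + 1) ^_) k≡2q ⟨
      (- + 1) ^ k               ≈⟨ ≈-sym (proj₂ (proj₂ paired)) ⟩
      + product units           ≈⟨ wilson (ℕ.≤∧≢⇒< 1<p (λ 2≡p → p≢2 p%4≡1 (sym 2≡p))) ⟩
      - + 1                     ∎
      where open ≈-Reasoning

  -- If -1 is a square then a·c² ≡ -1 forces a ≡ (y/c)² with y² ≡ -1, so
  -- a·c² ≢ -1 for every quadratic non-residue a.
  nonresidue-equation : ∀ {a} → QuadNonResidue p a → ¬ (∀ y → ¬ (y * y ≈ - + 1)) →
    ∀ c → ¬ (+ a * (c * c) ≈ - + 1)
  nonresidue-equation {a} non-residue -1-square c ac²≈-1 = -1-square λ y y²≈-1 →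
    non-residue ((y * d) %ℕ p) (≈⇒%≡ (square≈a y y²≈-1))
    where
    open ≈-Reasoning
    c′ = c %ℕ p
    0<c′ : 0 < c′
    0<c′ = ℕ.n≢0⇒n>0 λ c′≡0 → -1≉0 (begin
      - + 1                  ≈⟨ ≈-sym ac²≈-1 ⟩
      + a * (c * c)          ≈⟨ *-congˡ (+ a) (*-cong (c≈0 c′≡0) (c≈0 c′≡0)) ⟩
      + a * (+ 0 * + 0)      ≡⟨ *-zeroʳ (+ a) ⟩
      + 0                    ∎)
      where
      c≈0 : c′ ≡ 0 → c ≈ + 0
      c≈0 c′≡0 = subst (λ n → c ≈ + n) c′≡0 (≈-residue c)
    d = inverse c′
    cd≈1 : c * d ≈ + 1
    cd≈1 = ≈-trans (*-cong (≈-residue c) (≈-refl {d})) (inverse-spec 0<c′ (n%ℕd<d c p))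
    square≈a : ∀ y → y * y ≈ - + 1 → + (((y * d) %ℕ p) ℕ.* ((y * d) %ℕ p)) ≈ + a
    square≈a y y²≈-1 = begin
      + (z ℕ.* z)                   ≡⟨ pos-* z z ⟩
      + z * + z                     ≈⟨ *-cong (≈-sym (≈-residue (y * d))) (≈-sym (≈-residue (y * d))) ⟩
      (y * d) * (y * d)             ≡⟨ regroup y d ⟩
      (y * y) * (d * d)             ≈⟨ *-cong y²≈-1 (≈-refl {d * d}) ⟩
      - + 1 * (d * d)               ≈⟨ *-cong (≈-sym ac²≈-1) (≈-refl {d * d}) ⟩
      + a * (c * c) * (d * d)       ≡⟨ regroup′ (+ a) c d ⟩
      + a * ((c * d) * (c * d))     ≈⟨ *-congˡ (+ a) (*-cong cd≈1 cd≈1) ⟩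
      + a * (+ 1 * + 1)             ≡⟨ *-identityʳ (+ a) ⟩
      + a                           ∎
      where
      z = (y * d) %ℕ p
      regroup : ∀ y d → (y * d) * (y * d) ≡ (y * y) * (d * d)
      regroup = solve-∀
      regroup′ : ∀ a c d → a * (c * c) * (d * d) ≡ a * ((c * d) * (c * d))
      regroup′ = solve-∀

-- An element of Γ with zero trace, x1 i + x2 j + x3 ij, has norm
-- -a x1² - p x2² + a p x3² = 1, hence a·x1² ≡ -1 (mod p).
trace-zero-congruence : ∀ p a x1 x2 x3 → InΓ p a (quad (+ 0) x1 x2 x3) →
  Congruence._≈_ p (+ a * (x1 * x1)) (- + 1)
trace-zero-congruence p a x1 x2 x3 det≡1 = Congruence.≈-by p k (begin
  A * (x1 * x1) - - + 1                          ≡⟨ norm-identity x1 x2 x3 A P ⟩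
  k * P + (+ 1 - det p a (quad (+ 0) x1 x2 x3))  ≡⟨ cong (λ d → k * P + (+ 1 - d)) det≡1 ⟩
  k * P + + 0                                    ≡⟨ +-identityʳ (k * P) ⟩
  k * P                                          ∎)
  where
  open ≡-Reasoning
  A = + a
  P = + p
  k = A * (x3 * x3) - x2 * x2
  norm-identity : ∀ x1 x2 x3 A P → A * (x1 * x1) - - + 1
    ≡ (A * (x3 * x3) - x2 * x2) * P
      + (+ 1 - (+ 0 * + 0 - A * (x1 * x1) - P * (x2 * x2) + A * P * (x3 * x3)))
  norm-identity = solve-∀

-- If its trace 2·x0 is
-- non-zero this is torsion-nonzero-trace; if x0 = 0 then a·x1² ≡ -1 (mod p),
-- impossible since -1 is a square (p ≡ 1 mod 4) and a is a non-residue.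
lemma12 : (p a : ℕ) → (pr : Prime p) → p % 4 ≡ 1 → 0 < a → a < p →
    QuadNonResidue p a {{prime⇒nonZero pr}} →
    (g : Quad) → InΓ p a g →
    (n : ℕ) → n ≥ 1 → pow p a g n ≡ idΓ →
    (g ≡ idΓ) ⊎ (g ≡ negIdΓ)
lemma12 p a pr p%4≡1 _ _ non-residue (quad x0 x1 x2 x3) det≡1 (suc n) _ gⁿ⁺¹≡1 with x0 ≟ + 0
... | no x0≢0 = torsion-nonzero-trace p a x0 x1 x2 x3 det≡1 x0≢0 n gⁿ⁺¹≡1
... | yes refl = ⊥-elim (nonresidue-equation non-residue (minus-one-square p%4≡1) x1
                           (trace-zero-congruence p a x1 x2 x3 det≡1))
  where open Residues pr
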